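{- Let $T$ be a tree with $n\ge1$ vertices, let $t\in\{1,\dots,n\}$, let $\ell\ge n$ be an integer, and let $\nu$ be a self-reachable configuration on $T$ with $\ell$ chips. Let $d=\deg(v_t)$. Then $\nu$ is near-minimally self-reachable about $v_t$ if and only if $\nu_t=\ell+d+1-n$ (which is the maximum possible number of chips on $v_t$ for a self-reachable configuration on $T$ with $\ell$ chips).
   Context: Label the vertices $v_1,\dots,v_n$; $e_i$ is the $i$th standard basis vector. A chip configuration on $T$ is a vector $c\in\mathbb{Z}_{\ge0}^n$. The Laplacian $\Delta(T)$ has $\Delta_{ii}=\deg(v_i)$, $\Delta_{ij}=-1$ if $v_iv_j$ is an edge, $0$ otherwise; firing $v_i$ from $c$ produces $c-\Delta(T)e_i$, legal if $c_i\ge\deg(v_i)$. A configuration is self-reachable on $T$ if some nonempty finite sequence of legal firings starting from it returns to it. (Known: equivalently, it has at least $m-1$ chips on every $m$-vertex subtree.) It is minimally self-reachable if self-reachable with exactly $n-1$ chips. A configuration $\nu$ is near-minimally self-reachable if it is self-reachable and not minimally self-reachable, and there is a unique $i$ with $\nu-e_i$ self-reachable on $T$; it is then called near-minimally self-reachable about $v_i$. -}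

module Defs where

open import Data.Bool using (Bool; true; false; if_then_else_; T)
open import Data.Nat using (ℕ; zero; suc; _+_; _∸_; _≤_; pred)
open import Data.Fin using (Fin; _≟_)
open import Data.Fin.Properties using ()
open import Data.List using (List; []; _∷_; _++_; [_]; length; head; last)
open import Data.List.Relation.Unary.Unique.Propositional using (Unique)
open import Data.Vec using (Vec; lookup; tabulate; allFin; countᵇ; sum; _[_]%=_)
open import Data.Product using (Σ; ∃; _×_)
open import Data.Unit using (⊤)
open import Data.Maybe using (Maybe; just)
open import Relation.Nullary using (¬_; does)
open import Relation.Binary.PropositionalEquality using (_≡_)
open import Relation.Binary.Construct.Closure.Transitive using (TransClosure)

-- Finite simple graph on vertex set Fin n (vertex v_{i+1} is  i : Fin n).
record Graph (n : ℕ) : Set where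
  field
    Adj    : Fin n → Fin n → Bool
    sym    : ∀ i j → Adj i j ≡ Adj j i
    irrefl : ∀ i → Adj i i ≡ false
open Graph public

module _ {n : ℕ} (G : Graph n) where

  AdjChain : List (Fin n) → Set
  AdjChain []           = ⊤
  AdjChain (x ∷ [])     = ⊤
  AdjChain (x ∷ y ∷ xs) = T (Adj G x y) × AdjChain (y ∷ xs)

  Connected : Set
  Connected = ∀ i j → ∃ λ (xs : List (Fin n)) →
    AdjChain xs × head xs ≡ just i × last xs ≡ just j

  HasCycle : Set
  HasCycle = ∃ λ (x : Fin n) → ∃ λ (xs : List (Fin n)) →
    Unique (x ∷ xs) × 2 ≤ length xs × AdjChain (x ∷ xs ++ [ x ])

  IsTree : Set
  IsTree = Connected × ¬ HasCycle

  deg : Fin n → ℕ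
  deg i = countᵇ (Adj G i) (allFin n)

  Config : Set
  Config = Vec ℕ n

  fire : Config → Fin n → Config
  fire c i = tabulate λ j →
    if does (j ≟ i) then lookup c i ∸ deg i
    else if Adj G i j then suc (lookup c j)
    else lookup c j

  data Step : Config → Config → Set where
    legal : ∀ c i → deg i ≤ lookup c i → Step c (fire c i)

  SelfReachable : Config → Set
  SelfReachable c = TransClosure Step c c

  chips : Config → ℕ
  chips c = sum c

  MinimallySelfReachable : Config → Set
  MinimallySelfReachable c = SelfReachable c × chips c ≡ n ∸ 1

  MinusSelfReachable : Config → Fin n → Set
  MinusSelfReachable ν i = 1 ≤ lookup ν i × SelfReachable (ν [ i ]%= pred)

  NearMinimallySelfReachableAbout : Config → Fin n → Set
  NearMinimallySelfReachableAbout ν t =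
    SelfReachable ν × ¬ MinimallySelfReachable ν ×
    MinusSelfReachable ν t × (∀ j → MinusSelfReachable ν j → j ≡ t)

-- A configuration c is self-reachable exactly when some injective ranking r of the vertices
-- leaves every vertex v at least outDeg r v chips, the number of its neighbours ranked above it:
-- firing the vertices once each in increasing rank returns to c, and conversely ranking the
-- vertices by the time of their last firing in a cycle works (on a connected graph every vertex
-- fires). Orienting each edge of a tree from its lower to its higher end gives
-- ∑ outDeg r = n − 1, so such c carry at least n − 1 + c t − outDeg r t chips.
--
-- If ν is near-minimal about t, take a ranking r for ν − e_t. Any ν − e_j with j ≠ t would be
-- self-reachable if ν_j > outDeg r j, so the chip count above is attained; and every neighbour of
-- t lies above t, since otherwise moving t just below its highest lower neighbour u gives a ranking
-- for ν − e_u. Hence outDeg r t = deg t and ν_t = ℓ + deg t + 1 − n. Conversely, that value forces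
-- ν_t > deg t, so ν's own ranking serves ν − e_t, while a ranking for some ν − e_j, j ≠ t, would
-- need more than ℓ − 1 chips.

module Submission where

open import Data.Bool using (Bool; true; false; if_then_else_; T; _∧_; _∨_; not)
import Data.Bool as Bool
open import Data.Bool.Properties using (T-∧; T-≡; ∨-identityʳ; ∨-zeroʳ; ∧-identityʳ; ∧-zeroʳ)
open import Data.Empty using (⊥; ⊥-elim)
open import Data.Fin using (Fin; zero; suc; _≟_; punchIn; fromℕ<)
open import Data.Fin.Properties using (punchInᵢ≢i; any?; injective⇒≤) renaming (suc-injective to fsuc-injective)
open import Data.List using (List; []; _∷_; _++_; length)
import Data.List as List
open import Data.List.Extrema.Nat using (argmax; v≤f[argmax]⁺)
open import Data.List.Membership.Propositional.Properties using (∈-lookup; ∈-∃++; ∈-allFin)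
open import Data.List.Relation.Unary.All using (All; []; _∷_)
import Data.List.Relation.Unary.All as All
open import Data.List.Relation.Unary.All.Properties using (++⁻ˡ; ++⁻ʳ; ¬Any⇒All¬)
open import Data.List.Relation.Unary.AllPairs using ([]; _∷_)
import Data.List.Relation.Unary.Any as Any
open import Data.List.Relation.Unary.Unique.Propositional using (Unique)
open import Data.Maybe using (just)
open import Data.Nat using (ℕ; zero; suc; pred; _+_; _∸_; _≤_; _<_; _<ᵇ_; z≤n; s≤s; s≤s⁻¹; z<s; >-nonZero)
open import Data.Nat.Properties hiding (_≟_)
open import Data.Nat.Properties using () renaming (_≟_ to _≟ℕ_)
open import Algebra.Properties.CommutativeMonoid.Sum +-0-commutativeMonoid
  using (sum; sum-cong-≗; sum-remove; ∑-distrib-+; sum-replicate-zero)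
open import Data.Product using (Σ; ∃; _×_; _,_; proj₁; proj₂)
open import Data.Sum using (_⊎_; inj₁; inj₂; [_,_]′)
open import Data.Unit using (tt)
open import Data.Vec using (Vec; []; _∷_; lookup; tabulate; countᵇ; _[_]%=_)
import Data.Vec as Vec
open import Data.Vec.Properties
  using (lookup∘tabulate; tabulate∘lookup; tabulate-cong; lookup∘updateAt; lookup∘updateAt′)
open import Defs hiding (sym)
open import Function using (_∘_; id; Injective; _⇔_; mk⇔; module Equivalence)
open import Relation.Binary.Construct.Closure.ReflexiveTransitive using (Star; ε; _◅_; _◅◅_)
open import Relation.Binary.Construct.Closure.Transitive using (TransClosure; [_]; _∷_; _∷ʳ_)
open import Relation.Binary.Definitions using (tri<; tri≈; tri>)
open import Relation.Binary.PropositionalEquality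
  using (_≡_; _≢_; _≗_; ≢-sym; refl; sym; trans; cong; cong₂; subst; subst₂; module ≡-Reasoning)
open import Relation.Nullary using (¬_; Dec; yes; no; does; contradiction)
open import Relation.Nullary.Decidable using (dec-true; dec-false; _×-dec_)

𝟙 : Bool → ℕ
𝟙 b = if b then 1 else 0

𝟙≤1 : ∀ b → 𝟙 b ≤ 1
𝟙≤1 false = z≤n
𝟙≤1 true  = ≤-refl

≡true⇒T : ∀ {b} → b ≡ true → T b
≡true⇒T = Equivalence.from T-≡

≡false⇒¬T : ∀ {b} → b ≡ false → ¬ T b
≡false⇒¬T refl ()

𝟙-true : ∀ {b} → T b → 𝟙 b ≡ 1
𝟙-true {true} _ = refl

𝟙-false : ∀ {b} → ¬ T b → 𝟙 b ≡ 0
𝟙-false {false} _  = refl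
𝟙-false {true}  ¬b = contradiction tt ¬b

𝟙-mono : ∀ {a b} → (T a → T b) → 𝟙 a ≤ 𝟙 b
𝟙-mono {false}        _   = z≤n
𝟙-mono {true} {true}  _   = ≤-refl
𝟙-mono {true} {false} a⇒b = ⊥-elim (a⇒b tt)

if-suc≡+𝟙 : ∀ b x → (if b then suc x else x) ≡ x + 𝟙 b
if-suc≡+𝟙 true  x = +-comm 1 x
if-suc≡+𝟙 false x = sym (+-identityʳ x)

if-+-∸-comm : ∀ b x d k → (T b → d ≤ x) → (if b then x + k ∸ d else x + k) ≡ (if b then x ∸ d else x) + k
if-+-∸-comm true  x d k d≤x = +-∸-comm k (d≤x tt)
if-+-∸-comm false x d k _   = refl

<ᵇ-suc : ∀ {x k} → x ≢ k → (x <ᵇ suc k) ≡ (x <ᵇ k)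
<ᵇ-suc {zero}  {zero}  x≢k = contradiction refl x≢k
<ᵇ-suc {zero}  {suc k} _   = refl
<ᵇ-suc {suc x} {zero}  _   = refl
<ᵇ-suc {suc x} {suc k} x≢k = <ᵇ-suc (x≢k ∘ cong suc)

<ᵇ-irrefl : ∀ x → (x <ᵇ x) ≡ false
<ᵇ-irrefl zero    = refl
<ᵇ-irrefl (suc x) = <ᵇ-irrefl x

<⇒<ᵇ≡true : ∀ {x y} → x < y → (x <ᵇ y) ≡ true
<⇒<ᵇ≡true = Equivalence.to T-≡ ∘ <⇒<ᵇ

double-<⁻ : ∀ {a b} → a + a < b + b → a < b
double-<⁻ {a} {b} 2a<2b = ≰⇒> λ b≤a → <⇒≱ 2a<2b (+-mono-≤ b≤a b≤a)

double-≤⁻ : ∀ {a b} → a + a < suc (b + b) → a ≤ b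
double-≤⁻ {a} {b} 2a<1+2b = ≮⇒≥ λ b<a →
  <⇒≱ 2a<1+2b (≤-trans (n≤1+n _) (subst (_≤ a + a) (cong suc (+-suc b b)) (+-mono-≤ b<a b<a)))

double≢odd : ∀ a b → a + a ≢ suc (b + b)
double≢odd zero    _       ()
double≢odd (suc a) zero    eq = contradiction (trans (sym (+-suc a a)) (suc-injective eq)) λ ()
double≢odd (suc a) (suc b) eq =
  double≢odd a b (suc-injective (trans (sym (+-suc a a)) (trans (suc-injective eq) (cong suc (+-suc b b)))))

m≡n∸o⇔m+o≡n : ∀ {m n o} → o ≤ n → (m ≡ n ∸ o) ⇔ (m + o ≡ n)
m≡n∸o⇔m+o≡n {m} {n} {o} o≤n =
  mk⇔ (λ m≡n∸o → trans (cong (_+ o) m≡n∸o) (m∸n+n≡m o≤n))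
      (λ m+o≡n → trans (sym (m+n∸n≡m m o)) (cong (_∸ o) m+o≡n))

-- The rank of a vertex once a firing is prepended to a firing sequence: later firings shift up
-- by one, and rank 1 goes to the prepended vertex unless it fires again.
bump : ∀ {P : Set} → ℕ → Dec P → ℕ
bump (suc k) _       = suc (suc k)
bump zero    (yes _) = 1
bump zero    (no _)  = 0

bump-pos : ∀ {P : Set} x (p? : Dec P) → 0 < x ⊎ P → 0 < bump x p?
bump-pos (suc k) _        _        = z<s
bump-pos zero    (yes _)  _        = z<s
bump-pos zero    (no ¬p)  (inj₂ p) = contradiction p ¬p

bump-zero-no : ∀ {P : Set} (p? : Dec P) → ¬ P → bump 0 p? ≡ 0
bump-zero-no (yes p) ¬p = contradiction p ¬p
bump-zero-no (no _)  _  = refl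

bump-<⁻ : ∀ {P Q : Set} x (p? : Dec P) y (q? : Dec Q) → bump x p? < bump y q? → x < y ⊎ (x ≡ 0 × ¬ P × Q)
bump-<⁻ (suc k) _       (suc l) _       (s≤s (s≤s k<l)) = inj₁ (s≤s k<l)
bump-<⁻ (suc k) _       zero    (yes _) (s≤s ())
bump-<⁻ zero    (yes _) (suc l) _       _               = inj₁ z<s
bump-<⁻ zero    (yes _) zero    (yes _) (s≤s ())
bump-<⁻ zero    (no _)  (suc l) _       _               = inj₁ z<s
bump-<⁻ zero    (no ¬p) zero    (yes q) _               = inj₂ (refl , ¬p , q)

bump-injective⁺ : ∀ {P Q : Set} x (p? : Dec P) y (q? : Dec Q) → bump x p? ≡ bump y q? → 0 < bump x p? →
                  (x ≡ y × 0 < x) ⊎ (P × Q)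
bump-injective⁺ (suc k) _       (suc l) _       refl _ = inj₁ (refl , z<s)
bump-injective⁺ zero    (yes p) zero    (yes q) _    _ = inj₂ (p , q)
bump-injective⁺ (suc k) _       zero    (yes _) ()   _
bump-injective⁺ (suc k) _       zero    (no _)  ()   _
bump-injective⁺ zero    (yes _) (suc l) _       ()   _
bump-injective⁺ zero    (yes _) zero    (no _)  ()   _

sum-mono-≤ : ∀ {n} {f g : Fin n → ℕ} → (∀ i → f i ≤ g i) → sum f ≤ sum g
sum-mono-≤ {zero}  _   = z≤n
sum-mono-≤ {suc n} f≤g = +-mono-≤ (f≤g zero) (sum-mono-≤ (f≤g ∘ suc))

term≤sum : ∀ {n} (f : Fin n → ℕ) i → f i ≤ sum f
term≤sum f zero    = m≤m+n _ _
term≤sum f (suc i) = ≤-trans (term≤sum (f ∘ suc) i) (m≤n+m _ _)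

sum-pos : ∀ {n} (f : Fin n → ℕ) → 0 < sum f → ∃ λ i → 0 < f i
sum-pos {suc n} f 0<Σ with f zero in f₀≡
... | suc _ = zero , subst (0 <_) (sym f₀≡) z<s
... | zero  with i , 0<fᵢ ← sum-pos (f ∘ suc) 0<Σ = suc i , 0<fᵢ

sum-zero : ∀ {n} {f : Fin n → ℕ} → (∀ i → f i ≡ 0) → sum f ≡ 0
sum-zero {n} f≡0 = trans (sum-cong-≗ f≡0) (sum-replicate-zero n)

sum-one : ∀ n → sum {n} (λ _ → 1) ≡ n
sum-one zero    = refl
sum-one (suc n) = cong suc (sum-one n)

sum-except-≤ : ∀ {n} (i : Fin n) {f g : Fin n → ℕ} → (∀ j → j ≢ i → f j ≤ g j) →
               sum f + g i ≤ sum g + f i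
sum-except-≤ {suc n} i {f} {g} f≤g = begin
  sum f + g i                     ≡⟨ cong (_+ g i) (sum-remove f) ⟩
  f i + sum (f ∘ punchIn i) + g i ≤⟨ +-monoˡ-≤ (g i) (+-monoʳ-≤ (f i) (sum-mono-≤ off-i)) ⟩
  f i + sum (g ∘ punchIn i) + g i ≡⟨ swap (f i) _ (g i) ⟩
  g i + sum (g ∘ punchIn i) + f i ≡⟨ cong (_+ f i) (sum-remove g) ⟨
  sum g + f i                     ∎
  where
  open ≤-Reasoning
  off-i : ∀ j → f (punchIn i j) ≤ g (punchIn i j)
  off-i j = f≤g (punchIn i j) (punchInᵢ≢i i j)
  swap : ∀ a b c → a + b + c ≡ c + b + a
  swap a b c = trans (+-comm (a + b) c) (trans (cong (c +_) (+-comm a b)) (sym (+-assoc c b a)))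

sum-except-≡ : ∀ {n} (i : Fin n) {f g : Fin n → ℕ} → (∀ j → j ≢ i → f j ≡ g j) →
               sum f + g i ≡ sum g + f i
sum-except-≡ i f≡g = ≤-antisym (sum-except-≤ i (λ j j≢i → ≤-reflexive (f≡g j j≢i)))
                               (sum-except-≤ i (λ j j≢i → ≤-reflexive (sym (f≡g j j≢i))))

sum-lookup : ∀ {n} (c : Vec ℕ n) → Vec.sum c ≡ sum (lookup c)
sum-lookup []      = refl
sum-lookup (x ∷ c) = cong (x +_) (sum-lookup c)

countᵇ-tabulate : ∀ {n} {A : Set} (p : A → Bool) (f : Fin n → A) →
                  countᵇ p (tabulate f) ≡ sum (𝟙 ∘ p ∘ f)
countᵇ-tabulate {zero}  p f = refl
countᵇ-tabulate {suc n} p f with p (f zero)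
... | true  = cong suc (countᵇ-tabulate p (f ∘ suc))
... | false = countᵇ-tabulate p (f ∘ suc)

sum-pos-except : ∀ {n} (f : Fin n → ℕ) p → f p < sum f → ∃ λ w → w ≢ p × 0 < f w
sum-pos-except f zero fp<Σ
  with w , 0<fw ← sum-pos (f ∘ suc) (+-cancelˡ-< (f zero) 0 _ (subst (_< sum f) (sym (+-identityʳ (f zero))) fp<Σ))
  = suc w , (λ ()) , 0<fw
sum-pos-except f (suc p) fp<Σ with f zero in f₀
... | suc _ = zero , (λ ()) , subst (0 <_) (sym f₀) z<s
... | zero with w , w≢p , 0<fw ← sum-pos-except (f ∘ suc) p fp<Σ = suc w , w≢p ∘ fsuc-injective , 0<fw

module _ {A : Set} where

  lookup-injective : ∀ {xs : List A} → Unique xs → Injective _≡_ _≡_ (List.lookup xs)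
  lookup-injective {_ ∷ _} (_  ∷ _) {zero}  {zero}  _  = refl
  lookup-injective {_ ∷ _} (x∉ ∷ _) {zero}  {suc j} eq = contradiction eq (All.lookup x∉ (∈-lookup j))
  lookup-injective {_ ∷ _} (x∉ ∷ _) {suc i} {zero}  eq = contradiction (sym eq) (All.lookup x∉ (∈-lookup i))
  lookup-injective {_ ∷ _} (_  ∷ u) {suc i} {suc j} eq = cong suc (lookup-injective u eq)

  unique-split : ∀ {w : A} xs {ys} → Unique (xs ++ w ∷ ys) → Unique (w ∷ xs)
  unique-split []       (_ ∷ _)    = [] ∷ []
  unique-split (x ∷ xs) (x∉ ∷ u) with w∉xs ∷ uxs ← unique-split xs u =
    (≢-sym (All.head (++⁻ʳ xs x∉)) ∷ w∉xs) ∷ ++⁻ˡ xs x∉ ∷ uxs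

Unique⇒length≤ : ∀ {n} {xs : List (Fin n)} → Unique xs → length xs ≤ n
Unique⇒length≤ u = injective⇒≤ (lookup-injective u)

module _ {A : Set} {R : A → A → Set} where

  _◅⁺_ : ∀ {x y z} → Star R x y → TransClosure R y z → TransClosure R x z
  ε        ◅⁺ y⁺z = y⁺z
  (s ◅ ss) ◅⁺ y⁺z = s ∷ (ss ◅⁺ y⁺z)

  _⁺▻_ : ∀ {x y z} → TransClosure R x y → Star R y z → TransClosure R x z
  x⁺y ⁺▻ ε        = x⁺y
  x⁺y ⁺▻ (s ◅ ss) = (x⁺y ∷ʳ s) ⁺▻ ss

Subset : ℕ → Set
Subset n = Fin n → Bool

module _ {n : ℕ} where

  sumOver : Subset n → (Fin n → ℕ) → ℕ
  sumOver S f = sum λ v → if S v then f v else 0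

  syntax sumOver S (λ v → e) = ∑[ v ∈ S ] e

  size : Subset n → ℕ
  size S = ∑[ v ∈ S ] 1

  insert : Subset n → Fin n → Subset n
  insert S b w = S w ∨ does (w ≟ b)

  remove : Subset n → Fin n → Subset n
  remove S b w = S w ∧ not (does (w ≟ b))

  insert-self : ∀ S b → insert S b b ≡ true
  insert-self S b = trans (cong (S b ∨_) (dec-true (b ≟ b) refl)) (∨-zeroʳ (S b))

  insert-other : ∀ S {b w} → w ≢ b → insert S b w ≡ S w
  insert-other S {b} {w} w≢b = trans (cong (S w ∨_) (dec-false (w ≟ b) w≢b)) (∨-identityʳ (S w))

  remove-self : ∀ S b → remove S b b ≡ false
  remove-self S b = trans (cong (λ x → S b ∧ not x) (dec-true (b ≟ b) refl)) (∧-zeroʳ (S b))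

  insert-remove : ∀ {S b} → S b ≡ true → insert (remove S b) b ≗ S
  insert-remove {S} {b} Sb w with w ≟ b
  ... | yes refl = trans (∨-zeroʳ _) (sym Sb)
  ... | no _     = trans (∨-identityʳ _) (∧-identityʳ (S w))

  sumOver-cong : ∀ {S S' : Subset n} {f g : Fin n → ℕ} → S ≗ S' → f ≗ g → sumOver S f ≡ sumOver S' g
  sumOver-cong S≗S' f≗g = sum-cong-≗ λ v → cong₂ (λ b x → if b then x else 0) (S≗S' v) (f≗g v)

  sumOver-+ : ∀ S (f g : Fin n → ℕ) → ∑[ v ∈ S ] (f v + g v) ≡ sumOver S f + sumOver S g
  sumOver-+ S f g = trans (sum-cong-≗ split) (∑-distrib-+ (λ v → if S v then f v else 0) _)
    where
    split : ∀ v → (if S v then f v + g v else 0) ≡ (if S v then f v else 0) + (if S v then g v else 0)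
    split v with S v
    ... | true  = refl
    ... | false = refl

  sumOver-complement : ∀ S (f : Fin n → ℕ) → sumOver S f + ∑[ v ∈ not ∘ S ] f v ≡ sum f
  sumOver-complement S f = trans (sym (∑-distrib-+ (λ v → if S v then f v else 0) _)) (sum-cong-≗ split)
    where
    split : ∀ v → (if S v then f v else 0) + (if not (S v) then f v else 0) ≡ f v
    split v with S v
    ... | true  = +-identityʳ (f v)
    ... | false = refl

  sumOver≤sum : ∀ S (f : Fin n → ℕ) → sumOver S f ≤ sum f
  sumOver≤sum S f = sum-mono-≤ λ v → if-≤ (S v)
    where
    if-≤ : ∀ b {x} → (if b then x else 0) ≤ x
    if-≤ true  = ≤-refl
    if-≤ false = z≤n

  sumOver-insert : ∀ {S b} (f : Fin n → ℕ) → S b ≡ false → sumOver (insert S b) f ≡ sumOver S f + f b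
  sumOver-insert {S} {b} f Sb≡false = begin
    sumOver (insert S b) f               ≡⟨ +-identityʳ _ ⟨
    sumOver (insert S b) f + at-b false  ≡⟨ cong (λ x → sumOver (insert S b) f + at-b x) Sb≡false ⟨
    sumOver (insert S b) f + at-b (S b)
      ≡⟨ sum-except-≡ b (λ v v≢b → cong (λ x → if x then f v else 0) (insert-other S v≢b)) ⟩
    sumOver S f + at-b (insert S b b)    ≡⟨ cong (λ x → sumOver S f + at-b x) (insert-self S b) ⟩
    sumOver S f + f b                    ∎
    where
    open ≡-Reasoning
    at-b : Bool → ℕ
    at-b x = if x then f b else 0

  sumOver-remove : ∀ {S b} (f : Fin n → ℕ) → S b ≡ true → sumOver S f ≡ sumOver (remove S b) f + f b
  sumOver-remove {S} {b} f Sb = trans (sumOver-cong (λ w → sym (insert-remove {S} Sb w)) λ _ → refl)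
                                      (sumOver-insert {remove S b} f (remove-self S b))

  sumOver-empty : ∀ {S} (f : Fin n → ℕ) → size S ≡ 0 → sumOver S f ≡ 0
  sumOver-empty {S} f ∣S∣≡0 = sum-zero absent
    where
    absent : ∀ v → (if S v then f v else 0) ≡ 0
    absent v with S v in Sv
    ... | false = refl
    ... | true  = contradiction (subst (1 ≤_) ∣S∣≡0 (subst (λ x → (if x then 1 else 0) ≤ size S) Sv (term≤sum _ v)))
                                λ ()

  nonempty⇒member : ∀ {S k} → size S ≡ suc k → ∃ λ s → S s ≡ true
  nonempty⇒member {S} ∣S∣≡1+k with s , 0<𝟙 ← sum-pos _ (subst (0 <_) (sym ∣S∣≡1+k) z<s)
    with S s in Ss
  ... | true = s , Ss

  small⇒nonmember : ∀ {S} → size S < n → ∃ λ w → S w ≡ false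
  small⇒nonmember {S} ∣S∣<n with any? (λ w → S w Bool.≟ false)
  ... | yes found = found
  ... | no  none  = contradiction (trans (sum-cong-≗ member) (sum-one n)) (<⇒≢ ∣S∣<n)
    where
    member : ∀ w → (if S w then 1 else 0) ≡ 1
    member w with S w in Sw
    ... | true  = refl
    ... | false = contradiction (w , Sw) none

module _ {n : ℕ} (G : Graph n) where

  adjacent⇒≢ : ∀ {v u} → T (Adj G v u) → v ≢ u
  adjacent⇒≢ {v} v~v refl = subst T (irrefl G v) v~v

  deg≡sum : ∀ v → deg G v ≡ sum (λ u → 𝟙 (Adj G v u))
  deg≡sum v = countᵇ-tabulate (Adj G v) (λ u → u)

  degIn : Subset n → Fin n → ℕ
  degIn S v = ∑[ u ∈ S ] 𝟙 (Adj G v u)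

  up : (Fin n → ℕ) → Fin n → Fin n → Bool
  up r v u = Adj G v u ∧ (r v <ᵇ r u)

  outDeg : (Fin n → ℕ) → Fin n → ℕ
  outDeg r v = sum λ u → 𝟙 (up r v u)

  module _ {r : Fin n → ℕ} {v u : Fin n} where

    up-intro : T (Adj G v u) → r v < r u → T (up r v u)
    up-intro v~u rv<ru = Equivalence.from T-∧ (v~u , <⇒<ᵇ rv<ru)

    up-elim : T (up r v u) → T (Adj G v u) × r v < r u
    up-elim v↑u with v~u , rv<ᵇru ← Equivalence.to T-∧ v↑u = v~u , <ᵇ⇒< (r v) (r u) rv<ᵇru

  outDeg≤deg : ∀ r v → outDeg r v ≤ deg G v
  outDeg≤deg r v = ≤-trans (sum-mono-≤ λ u → 𝟙-mono (proj₁ ∘ up-elim {r} {v} {u})) (≤-reflexive (sym (deg≡sum v)))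

  module _ {r s : Fin n → ℕ} {v : Fin n} where

    outDeg-mono : (∀ u → T (Adj G v u) → r v < r u → s v < s u) → outDeg r v ≤ outDeg s v
    outDeg-mono r⇒s = sum-mono-≤ λ u → 𝟙-mono (transport u)
      where
      transport : ∀ u → T (up r v u) → T (up s v u)
      transport u v↑u with v~u , rv<ru ← up-elim v↑u = up-intro v~u (r⇒s u v~u rv<ru)

    outDeg-mono-except : ∀ p → (∀ u → u ≢ p → T (Adj G v u) → r v < r u → s v < s u) →
                         outDeg r v ≤ outDeg s v + 𝟙 (Adj G v p)
    outDeg-mono-except p r⇒s = begin
      outDeg r v                          ≤⟨ m≤m+n _ _ ⟩
      outDeg r v + 𝟙 (up s v p)           ≤⟨ sum-except-≤ p (λ u u≢p → 𝟙-mono (transport u u≢p)) ⟩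
      outDeg s v + 𝟙 (up r v p)           ≤⟨ +-monoʳ-≤ (outDeg s v) (𝟙-mono (proj₁ ∘ up-elim {r} {v} {p})) ⟩
      outDeg s v + 𝟙 (Adj G v p)          ∎
      where
      open ≤-Reasoning
      transport : ∀ u → u ≢ p → T (up r v u) → T (up s v u)
      transport u u≢p v↑u with v~u , rv<ru ← up-elim v↑u = up-intro v~u (r⇒s u u≢p v~u rv<ru)

    outDeg-drop : ∀ p → (∀ u → u ≢ p → T (Adj G v u) → s v < s u → r v < r u) →
                  T (up r v p) → ¬ T (up s v p) → suc (outDeg s v) ≤ outDeg r v
    outDeg-drop p s⇒r v↑ᵣp v↑̸ₛp = begin
      suc (outDeg s v)               ≡⟨ +-comm 1 _ ⟩
      outDeg s v + 1                 ≡⟨ cong (outDeg s v +_) (𝟙-true v↑ᵣp) ⟨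
      outDeg s v + 𝟙 (up r v p)      ≤⟨ sum-except-≤ p (λ u u≢p → 𝟙-mono (transport u u≢p)) ⟩
      outDeg r v + 𝟙 (up s v p)      ≡⟨ cong (outDeg r v +_) (𝟙-false v↑̸ₛp) ⟩
      outDeg r v + 0                 ≡⟨ +-identityʳ _ ⟩
      outDeg r v                     ∎
      where
      open ≤-Reasoning
      transport : ∀ u → u ≢ p → T (up s v u) → T (up r v u)
      transport u u≢p v↑u with v~u , sv<su ← up-elim v↑u = up-intro v~u (s⇒r u u≢p v~u sv<su)

  up+up≡Adj : ∀ {r} → Injective _≡_ _≡_ r → ∀ b u → 𝟙 (up r u b) + 𝟙 (up r b u) ≡ 𝟙 (Adj G b u)
  up+up≡Adj {r} r-inj b u rewrite Graph.sym G u b with Adj G b u in b~u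
  ... | false = refl
  ... | true with r u <ᵇ r b in u<b | r b <ᵇ r u in b<u
  ...   | false | true  = refl
  ...   | true  | false = refl
  ...   | true  | true  = contradiction (<ᵇ⇒< (r u) (r b) (≡true⇒T u<b)) (<-asym (<ᵇ⇒< (r b) (r u) (≡true⇒T b<u)))
  ...   | false | false = contradiction (r-inj (≤-antisym (≮⇒≥ (≡false⇒¬T u<b ∘ <⇒<ᵇ {r u} {r b}))
                                                          (≮⇒≥ (≡false⇒¬T b<u ∘ <⇒<ᵇ {r b} {r u}))))
                                        (adjacent⇒≢ (≡true⇒T b~u))

  module MoveBelow {r : Fin n → ℕ} (r-inj : Injective _≡_ _≡_ r) {t u : Fin n} (u↑t : T (up r u t))
                   (u-highest : ∀ w → T (up r w t) → r w ≤ r u) where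

    u~t : T (Adj G u t)
    u~t = proj₁ (up-elim {r} u↑t)

    ru<rt : r u < r t
    ru<rt = proj₂ (up-elim {r} u↑t)

    u≢t : u ≢ t
    u≢t = adjacent⇒≢ u~t

    -- t is moved to just below u; doubling the ranks makes room.
    r′ : Fin n → ℕ
    r′ w = if does (w ≟ t) then suc (r u + r u) else suc (suc (r w + r w))

    r′-t : r′ t ≡ suc (r u + r u)
    r′-t = cong (λ b → if b then suc (r u + r u) else suc (suc (r t + r t))) (dec-true (t ≟ t) refl)

    r′-other : ∀ {w} → w ≢ t → r′ w ≡ suc (suc (r w + r w))
    r′-other {w} w≢t = cong (λ b → if b then suc (r u + r u) else suc (suc (r w + r w))) (dec-false (w ≟ t) w≢t)

    r′-injective : Injective _≡_ _≡_ r′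
    r′-injective {a} {b} r′a≡r′b = by-cases (a ≟ t) (b ≟ t)
      where
      by-cases : Dec (a ≡ t) → Dec (b ≡ t) → a ≡ b
      by-cases (yes a≡t) (yes b≡t) = trans a≡t (sym b≡t)
      by-cases (yes refl) (no b≢t) =
        contradiction (suc-injective (trans (sym r′-t) (trans r′a≡r′b (r′-other b≢t)))) (double≢odd (r u) (r b))
      by-cases (no a≢t) (yes refl) =
        contradiction (suc-injective (trans (sym r′-t) (trans (sym r′a≡r′b) (r′-other a≢t)))) (double≢odd (r u) (r a))
      by-cases (no a≢t) (no b≢t) =
        r-inj (≤-antisym (double-≤⁻ (s≤s (≤-reflexive 2ra≡2rb))) (double-≤⁻ (s≤s (≤-reflexive (sym 2ra≡2rb)))))
        where
        2ra≡2rb : r a + r a ≡ r b + r b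
        2ra≡2rb = suc-injective (suc-injective (trans (sym (r′-other a≢t)) (trans r′a≡r′b (r′-other b≢t))))

    keeps-order : ∀ {x} → x ≢ t → ∀ w → r′ x < r′ w → r x < r w
    keeps-order {x} x≢t w r′x<r′w = by-cases (w ≟ t)
      where
      by-cases : Dec (w ≡ t) → r x < r w
      by-cases (yes refl) =
        <-trans (double-<⁻ (≤-trans (n≤1+n _) (s≤s⁻¹ (subst₂ _<_ (r′-other x≢t) r′-t r′x<r′w)))) ru<rt
      by-cases (no w≢t) = double-<⁻ (s≤s⁻¹ (s≤s⁻¹ (subst₂ _<_ (r′-other x≢t) (r′-other w≢t) r′x<r′w)))

    t-keeps-order : ∀ w → w ≢ u → T (Adj G t w) → r′ t < r′ w → r t < r w
    t-keeps-order w w≢u t~w r′t<r′w = ≤∧≢⇒< (≮⇒≥ w-not-below) (≢-sym (adjacent⇒≢ t~w) ∘ r-inj ∘ sym)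
      where
      ru<rw : r u < r w
      ru<rw = ≤∧≢⇒< (double-≤⁻ (s≤s⁻¹ (subst₂ _<_ r′-t (r′-other (≢-sym (adjacent⇒≢ t~w))) r′t<r′w)))
                    (≢-sym w≢u ∘ r-inj)
      w-not-below : ¬ r w < r t
      w-not-below rw<rt = <⇒≱ ru<rw (u-highest w (up-intro (subst T (Graph.sym G t w) t~w) rw<rt))

    u-loses-t : ¬ T (up r′ u t)
    u-loses-t u↑′t = <⇒≱ (proj₂ (up-elim {r′} u↑′t))
                         (≤-trans (≤-reflexive r′-t) (subst (suc (r u + r u) ≤_) (sym (r′-other u≢t)) (n≤1+n _)))

    outDeg′-t : outDeg r′ t ≤ outDeg r t + 1
    outDeg′-t = ≤-trans (outDeg-mono-except u t-keeps-order) (+-monoʳ-≤ (outDeg r t) (𝟙≤1 _))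

    outDeg′-u : outDeg r′ u < outDeg r u
    outDeg′-u = outDeg-drop t (λ w _ _ → keeps-order u≢t w) u↑t u-loses-t

    outDeg′-other : ∀ {x} → x ≢ t → outDeg r′ x ≤ outDeg r x
    outDeg′-other x≢t = outDeg-mono (λ w _ → keeps-order x≢t w)

  -- Firing in rank order

  -- c − Δ·1_F; the truncated subtraction is exact when the vertices of F can afford to fire,
  -- which is the hypothesis of fire-fireSet.
  afterFiring : Config G → Subset n → Fin n → ℕ
  afterFiring c F w = if F w then lookup c w + degIn F w ∸ deg G w else lookup c w + degIn F w

  fireSet : Config G → Subset n → Config G
  fireSet c F = tabulate (afterFiring c F)

  lookup-fireSet-unfired : ∀ c {F w} → F w ≡ false → lookup (fireSet c F) w ≡ lookup c w + degIn F w
  lookup-fireSet-unfired c {F} {w} Fw = trans (lookup∘tabulate _ w)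
    (cong (λ b → if b then lookup c w + degIn F w ∸ deg G w else lookup c w + degIn F w) Fw)

  degIn-insert : ∀ F {b} w → F b ≡ false → degIn (insert F b) w ≡ degIn F w + 𝟙 (Adj G w b)
  degIn-insert F w Fb = sumOver-insert {S = F} (λ u → 𝟙 (Adj G w u)) Fb

  fire-fireSet : ∀ c {F b} → F b ≡ false → (∀ w → T (F w) → deg G w ≤ lookup c w + degIn F w) →
                 fire G (fireSet c F) b ≡ fireSet c (insert F b)
  fire-fireSet c {F} {b} Fb fired-legal = tabulate-cong entry
    where
    open ≡-Reasoning
    L : Config G
    L = fireSet c F
    entry : ∀ j → (if does (j ≟ b) then lookup L b ∸ deg G b
                   else if Adj G b j then suc (lookup L j) else lookup L j)
                  ≡ afterFiring c (insert F b) j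
    entry j with j ≟ b
    ... | yes refl = begin
      lookup L j ∸ deg G j                         ≡⟨ cong (_∸ deg G j) (lookup-fireSet-unfired c Fb) ⟩
      X ∸ deg G j                                  ≡⟨ cong (λ x → lookup c j + x ∸ deg G j) no-loop ⟨
      Y ∸ deg G j                                  ≡⟨ cong (λ x → if x then Y ∸ deg G j else Y) (∨-zeroʳ (F j)) ⟨
      (if F j ∨ true then Y ∸ deg G j else Y)      ∎
      where
      X Y : ℕ
      X = lookup c j + degIn F j
      Y = lookup c j + degIn (insert F j) j
      no-loop : degIn (insert F j) j ≡ degIn F j
      no-loop = trans (degIn-insert F j Fb) (trans (cong (λ x → degIn F j + 𝟙 x) (irrefl G j)) (+-identityʳ _))
    ... | no j≢b = begin
      (if Adj G b j then suc (lookup L j) else lookup L j)  ≡⟨ if-suc≡+𝟙 (Adj G b j) (lookup L j) ⟩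
      lookup L j + 𝟙 (Adj G b j)
        ≡⟨ cong₂ _+_ (lookup∘tabulate _ j) (cong 𝟙 (Graph.sym G b j)) ⟩
      afterFiring c F j + 𝟙 (Adj G j b)                     ≡⟨ if-+-∸-comm (F j) X (deg G j) _ (fired-legal j) ⟨
      (if F j then X + 𝟙 (Adj G j b) ∸ deg G j else X + 𝟙 (Adj G j b))
        ≡⟨ cong₂ (λ f x → if f then x ∸ deg G j else x) (sym (∨-identityʳ (F j)))
                 (trans (+-assoc (lookup c j) (degIn F j) _) (cong (lookup c j +_) (sym (degIn-insert F j Fb)))) ⟩
      (if F j ∨ false then Y ∸ deg G j else Y)               ∎
      where
      X Y : ℕ
      X = lookup c j + degIn F j
      Y = lookup c j + degIn (insert F b) j

  fireSet-cong : ∀ c {F F'} → F ≗ F' → fireSet c F ≡ fireSet c F'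
  fireSet-cong c F≗F' = tabulate-cong λ w →
    cong₂ (λ f x → if f then x ∸ deg G w else x) (F≗F' w)
          (cong (lookup c w +_) (sumOver-cong F≗F' λ _ → refl))

  fireSet-none : ∀ c → fireSet c (λ _ → false) ≡ c
  fireSet-none c = trans (tabulate-cong λ w → trans (cong (lookup c w +_) (sum-replicate-zero n)) (+-identityʳ _))
                         (tabulate∘lookup c)

  fireSet-all : ∀ c → fireSet c (λ _ → true) ≡ c
  fireSet-all c = trans (tabulate-cong λ w → trans (cong (λ x → lookup c w + x ∸ deg G w) (sym (deg≡sum w)))
                                                   (m+n∸n≡m (lookup c w) (deg G w)))
                        (tabulate∘lookup c)

  record FiringOrder (c : Config G) : Set where
    field
      rank           : Fin n → ℕ
      rank-injective : Injective _≡_ _≡_ rank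
      outDeg≤chips   : ∀ v → outDeg rank v ≤ lookup c v

  module FireInRankOrder {c : Config G} (o : FiringOrder c) where
    open FiringOrder o

    firedBefore : ℕ → Subset n
    firedBefore k u = rank u <ᵇ k

    after : ℕ → Config G
    after k = fireSet c (firedBefore k)

    enough-to-fire : ∀ {w k} → rank w ≤ k → deg G w ≤ lookup c w + degIn (firedBefore k) w
    enough-to-fire {w} {k} rw≤k = begin
      deg G w                        ≡⟨ deg≡sum w ⟩
      sum (λ u → 𝟙 (Adj G w u))      ≡⟨ sumOver-complement F _ ⟨
      degIn F w + degIn (not ∘ F) w  ≤⟨ +-monoʳ-≤ (degIn F w) (sum-mono-≤ unfired-later) ⟩
      degIn F w + outDeg rank w      ≤⟨ +-monoʳ-≤ (degIn F w) (outDeg≤chips w) ⟩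
      degIn F w + lookup c w         ≡⟨ +-comm (degIn F w) (lookup c w) ⟩
      lookup c w + degIn F w         ∎
      where
      open ≤-Reasoning
      F : Subset n
      F = firedBefore k
      unfired-later : ∀ u → (if not (F u) then 𝟙 (Adj G w u) else 0) ≤ 𝟙 (up rank w u)
      unfired-later u with F u in Fu
      ... | true  = z≤n
      ... | false = 𝟙-mono λ w~u → up-intro w~u
                      (≤∧≢⇒< (≤-trans rw≤k (≮⇒≥ (≡false⇒¬T Fu ∘ <⇒<ᵇ))) (adjacent⇒≢ w~u ∘ rank-injective))

    after-rank : ∀ {v k} → rank v ≡ k → Step G (after k) (after (suc k))
    after-rank {v} {k} rv≡k = subst (Step G (after k)) fired (legal (after k) v legal-v)
      where
      F : Subset n
      F = firedBefore k
      Fv : F v ≡ false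
      Fv = subst (λ x → (rank v <ᵇ x) ≡ false) rv≡k (<ᵇ-irrefl (rank v))
      legal-v : deg G v ≤ lookup (after k) v
      legal-v = subst (deg G v ≤_) (sym (lookup-fireSet-unfired c Fv)) (enough-to-fire (≤-reflexive rv≡k))
      next : firedBefore (suc k) ≗ insert F v
      next u with u ≟ v
      ... | yes refl = trans (<⇒<ᵇ≡true (s≤s (≤-reflexive rv≡k))) (sym (∨-zeroʳ _))
      ... | no u≢v   = trans (<ᵇ-suc (u≢v ∘ rank-injective ∘ λ ru≡k → trans ru≡k (sym rv≡k)))
                             (sym (∨-identityʳ _))
      fired : fire G (after k) v ≡ after (suc k)
      fired = trans (fire-fireSet c Fv λ w w∈F → enough-to-fire {w} {k} (<⇒≤ (<ᵇ⇒< _ _ w∈F)))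
                    (sym (fireSet-cong c next))

    after-gap : ∀ {k} → (∀ u → rank u ≢ k) → after (suc k) ≡ after k
    after-gap gap = fireSet-cong c λ u → <ᵇ-suc (gap u)

    after-star : ∀ a m → Star (Step G) (after a) (after (a + m))
    after-star a zero    = subst (Star (Step G) (after a) ∘ after) (sym (+-identityʳ a)) ε
    after-star a (suc m) = subst (Star (Step G) (after a) ∘ after) (sym (+-suc a m))
                                 (next-rank ◅◅ after-star (suc a) m)
      where
      next-rank : Star (Step G) (after a) (after (suc a))
      next-rank with any? (λ v → rank v ≟ℕ a)
      ... | yes (v , rv≡a) = after-rank rv≡a ◅ ε
      ... | no  none       = subst (Star (Step G) (after a)) (sym (after-gap λ u ru≡a → none (u , ru≡a))) ε

    after-late : ∀ {k} → (∀ u → rank u < k) → after k ≡ c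
    after-late late = trans (fireSet-cong c λ u → <⇒<ᵇ≡true (late u)) (fireSet-all c)

    selfReachable : 0 < n → SelfReachable G c
    selfReachable 0<n = subst (λ x → TransClosure (Step G) x c) (fireSet-none c)
                          (after-star 0 k₀ ◅⁺ ([ after-rank refl ] ⁺▻ subst (Star (Step G) _) end
                                                                          (after-star (suc k₀) (sum rank))))
      where
      k₀ : ℕ
      k₀ = rank (fromℕ< 0<n)
      end : after (suc k₀ + sum rank) ≡ c
      end = after-late λ u → s≤s (≤-trans (term≤sum rank u) (m≤n+m _ _))

  firingOrder⇒selfReachable : 0 < n → ∀ {c} → FiringOrder c → SelfReachable G c
  firingOrder⇒selfReachable 0<n o = FireInRankOrder.selfReachable o 0<n

  -- Ranking by last firing

  ifUnfired : ℕ → ℕ → ℕ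
  ifUnfired zero    x = x
  ifUnfired (suc _) x = 0

  ifUnfired-pos : ∀ {x y} → 0 < x → ifUnfired x y ≡ 0
  ifUnfired-pos {suc _} _ = refl

  -- rank orders the vertices by their last firing on a sequence from c to z, and is 0 for those
  -- that never fire. After its last firing a vertex only gains chips, one from each neighbour that
  -- fires later.
  record LastFirings (c z : Config G) : Set where
    field
      rank       : Fin n → ℕ
      received   : ∀ v → outDeg rank v + ifUnfired (rank v) (lookup c v) ≤ lookup z v
      injective⁺ : ∀ {u v} → rank u ≡ rank v → 0 < rank u → u ≡ v

  lookup-fire-other : ∀ c {i v} → v ≢ i → lookup (fire G c i) v ≡ lookup c v + 𝟙 (Adj G v i)
  lookup-fire-other c {i} {v} v≢i = begin
    lookup (fire G c i) v                                          ≡⟨ lookup∘tabulate _ v ⟩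
    (if does (v ≟ i) then lookup c i ∸ deg G i else if Adj G i v then suc (lookup c v) else lookup c v)
      ≡⟨ cong (λ b → if b then lookup c i ∸ deg G i else if Adj G i v then suc (lookup c v) else lookup c v)
              (dec-false (v ≟ i) v≢i) ⟩
    (if Adj G i v then suc (lookup c v) else lookup c v)            ≡⟨ if-suc≡+𝟙 (Adj G i v) (lookup c v) ⟩
    lookup c v + 𝟙 (Adj G i v)                                      ≡⟨ cong (λ b → lookup c v + 𝟙 b) (Graph.sym G i v) ⟩
    lookup c v + 𝟙 (Adj G v i)                                      ∎
    where open ≡-Reasoning

  noFirings : ∀ {z} → LastFirings z z
  noFirings {z} = record
    { rank       = λ _ → 0
    ; received   = λ v → ≤-reflexive (cong (_+ lookup z v) (sum-zero λ u → cong 𝟙 (∧-zeroʳ (Adj G v u))))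
    ; injective⁺ = λ _ ()
    }

  prependFiring : Fin n → (Fin n → ℕ) → Fin n → ℕ
  prependFiring i s v = bump (s v) (v ≟ i)

  module Prepend {c z} i (o : LastFirings (fire G c i) z) where
    open LastFirings o renaming (rank to s)

    r : Fin n → ℕ
    r = prependFiring i s

    lifts : ∀ {v u} → r v < r u → s v < s u ⊎ (s v ≡ 0 × v ≢ i × u ≡ i)
    lifts {v} {u} = bump-<⁻ (s v) (v ≟ i) (s u) (u ≟ i)

    ¬fired : ∀ {v} → s v ≡ 0 → v ≢ i → ¬ (0 < s v ⊎ v ≡ i)
    ¬fired sv≡0 _   (inj₁ 0<sv) = contradiction (subst (0 <_) sv≡0 0<sv) λ ()
    ¬fired _    v≢i (inj₂ v≡i)  = v≢i v≡i

    outDeg-fired : ∀ {v} → 0 < s v ⊎ v ≡ i → outDeg r v ≤ outDeg s v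
    outDeg-fired {v} fired = outDeg-mono λ u _ rv<ru →
      [ id , (λ (sv≡0 , v≢i , _) → contradiction fired (¬fired sv≡0 v≢i)) ]′ (lifts rv<ru)

    outDeg-unfired : ∀ {v} → outDeg r v ≤ outDeg s v + 𝟙 (Adj G v i)
    outDeg-unfired = outDeg-mono-except i λ u u≢i _ rv<ru →
      [ id , (λ (_ , _ , u≡i) → contradiction u≡i u≢i) ]′ (lifts rv<ru)

    fired-case : ∀ {v} → 0 < s v ⊎ v ≡ i → outDeg r v + ifUnfired (r v) (lookup c v) ≤ lookup z v
    fired-case {v} fired = begin
      outDeg r v + ifUnfired (r v) (lookup c v)
        ≡⟨ cong (outDeg r v +_) (ifUnfired-pos (bump-pos (s v) (v ≟ i) fired)) ⟩
      outDeg r v + 0                                        ≡⟨ +-identityʳ _ ⟩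
      outDeg r v                                            ≤⟨ outDeg-fired fired ⟩
      outDeg s v                                            ≤⟨ m≤m+n _ _ ⟩
      outDeg s v + ifUnfired (s v) (lookup (fire G c i) v)  ≤⟨ received v ⟩
      lookup z v                                            ∎
      where open ≤-Reasoning

    unfired-case : ∀ {v} → s v ≡ 0 → v ≢ i → outDeg r v + ifUnfired (r v) (lookup c v) ≤ lookup z v
    unfired-case {v} sv≡0 v≢i = begin
      outDeg r v + ifUnfired (r v) (lookup c v)             ≡⟨ cong (λ x → outDeg r v + ifUnfired x (lookup c v)) rv≡0 ⟩
      outDeg r v + lookup c v                               ≤⟨ +-monoˡ-≤ (lookup c v) outDeg-unfired ⟩
      outDeg s v + 𝟙 (Adj G v i) + lookup c v               ≡⟨ +-assoc (outDeg s v) _ _ ⟩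
      outDeg s v + (𝟙 (Adj G v i) + lookup c v)
        ≡⟨ cong (outDeg s v +_) (trans (+-comm (𝟙 (Adj G v i)) (lookup c v)) (sym (lookup-fire-other c v≢i))) ⟩
      outDeg s v + lookup (fire G c i) v
        ≡⟨ cong (λ x → outDeg s v + ifUnfired x (lookup (fire G c i) v)) sv≡0 ⟨
      outDeg s v + ifUnfired (s v) (lookup (fire G c i) v)  ≤⟨ received v ⟩
      lookup z v                                            ∎
      where
      open ≤-Reasoning
      rv≡0 : r v ≡ 0
      rv≡0 = trans (cong (λ x → bump x (v ≟ i)) sv≡0) (bump-zero-no (v ≟ i) v≢i)

    received′ : ∀ v → outDeg r v + ifUnfired (r v) (lookup c v) ≤ lookup z v
    received′ v = by-cases (s v) refl (v ≟ i)
      where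
      by-cases : ∀ x → s v ≡ x → Dec (v ≡ i) → outDeg r v + ifUnfired (r v) (lookup c v) ≤ lookup z v
      by-cases (suc _) sv _         = fired-case (inj₁ (subst (0 <_) (sym sv) z<s))
      by-cases zero    _  (yes v≡i) = fired-case (inj₂ v≡i)
      by-cases zero    sv (no v≢i)  = unfired-case sv v≢i

    injective′ : ∀ {u v} → r u ≡ r v → 0 < r u → u ≡ v
    injective′ {u} {v} ru≡rv 0<ru with bump-injective⁺ (s u) (u ≟ i) (s v) (v ≟ i) ru≡rv 0<ru
    ... | inj₁ (su≡sv , 0<su) = injective⁺ su≡sv 0<su
    ... | inj₂ (u≡i , v≡i)    = trans u≡i (sym v≡i)

  lastFirings-prepend : ∀ {c z} i → LastFirings (fire G c i) z → LastFirings c z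
  lastFirings-prepend {c} i o = record { rank = r ; received = received′ ; injective⁺ = injective′ }
    where open Prepend {c} i o

  lastFirings-prepend-fires : ∀ {c z} i (o : LastFirings (fire G c i) z) →
                              0 < LastFirings.rank (lastFirings-prepend {c} i o) i
  lastFirings-prepend-fires i o = bump-pos (LastFirings.rank o i) (i ≟ i) (inj₂ refl)

  lastFirings : ∀ {c z} → TransClosure (Step G) c z → LastFirings c z
  lastFirings [ legal c i _ ]         = lastFirings-prepend {c} i noFirings
  lastFirings (legal c i _ ∷ firings) = lastFirings-prepend {c} i (lastFirings firings)

  lastFirings-someone-fires : ∀ {c z} (firings : TransClosure (Step G) c z) →
                              ∃ λ i → 0 < LastFirings.rank (lastFirings firings) i
  lastFirings-someone-fires [ legal c i _ ]         = i , lastFirings-prepend-fires {c} i noFirings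
  lastFirings-someone-fires (legal c i _ ∷ firings) = i , lastFirings-prepend-fires {c} i (lastFirings firings)

  selfReachable⇒firingOrder : Connected G → ∀ {c} → SelfReachable G c → FiringOrder c
  selfReachable⇒firingOrder conn {c} cycle = record
    { rank           = rank
    ; rank-injective = λ ru≡rv → injective⁺ ru≡rv (everyone-fires _)
    ; outDeg≤chips   = λ v → ≤-trans (m≤m+n _ _) (received v)
    }
    where
    open LastFirings (lastFirings cycle)

    spreads : ∀ {x y} → T (Adj G y x) → 0 < rank x → 0 < rank y
    spreads {x} {y} y~x 0<rx = n≢0⇒n>0 λ ry≡0 → 1+n≰n (begin
      1 + lookup c y                                ≤⟨ +-monoˡ-≤ (lookup c y) (x-above ry≡0) ⟩
      outDeg rank y + lookup c y                    ≡⟨ cong (λ k → outDeg rank y + ifUnfired k (lookup c y)) ry≡0 ⟨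
      outDeg rank y + ifUnfired (rank y) (lookup c y) ≤⟨ received y ⟩
      lookup c y                                    ∎)
      where
      open ≤-Reasoning
      x-above : rank y ≡ 0 → 1 ≤ outDeg rank y
      x-above ry≡0 = subst (_≤ outDeg rank y) (𝟙-true (up-intro y~x (subst (_< rank x) (sym ry≡0) 0<rx)))
                           (term≤sum _ x)

    fires-along : ∀ {w} x xs → AdjChain G (x ∷ xs) → List.last (x ∷ xs) ≡ just w → 0 < rank x → 0 < rank w
    fires-along x []       _              refl   0<rx = 0<rx
    fires-along x (y ∷ ys) (x~y , chain) last≡w 0<rx =
      fires-along y ys chain last≡w (spreads (subst T (Graph.sym G x y) x~y) 0<rx)

    everyone-fires : ∀ w → 0 < rank w
    everyone-fires w with i , 0<rᵢ ← lastFirings-someone-fires cycle with conn i w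
    ... | x ∷ xs , chain , refl , last≡w = fires-along x xs chain last≡w 0<rᵢ

  -- Edges of a tree

  edgesIn : (Fin n → ℕ) → Subset n → ℕ
  edgesIn r S = ∑[ v ∈ S ] ∑[ u ∈ S ] 𝟙 (up r v u)

  edgesIn-cong : ∀ r {S S'} → S ≗ S' → edgesIn r S ≡ edgesIn r S'
  edgesIn-cong r S≗S' = sumOver-cong S≗S' λ v → sumOver-cong S≗S' λ _ → refl

  edgesIn≤edges : ∀ r S → edgesIn r S ≤ sum (outDeg r)
  edgesIn≤edges r S = ≤-trans (sumOver≤sum S (λ v → ∑[ u ∈ S ] 𝟙 (up r v u)))
                              (sum-mono-≤ λ v → sumOver≤sum S (λ u → 𝟙 (up r v u)))

  edgesIn-insert : ∀ {r} → Injective _≡_ _≡_ r → ∀ {S b} → S b ≡ false →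
                   edgesIn r (insert S b) ≡ edgesIn r S + degIn S b
  edgesIn-insert {r} r-inj {S} {b} Sb = begin
    edgesIn r (insert S b)
      ≡⟨ sumOver-cong (λ _ → refl) (λ v → sumOver-insert {S = S} (e v) Sb) ⟩
    ∑[ v ∈ insert S b ] (sumOver S (e v) + e v b)
      ≡⟨ sumOver-insert {S = S} (λ v → sumOver S (e v) + e v b) Sb ⟩
    ∑[ v ∈ S ] (sumOver S (e v) + e v b) + (sumOver S (e b) + e b b)
      ≡⟨ cong₂ _+_ (sumOver-+ S (λ v → sumOver S (e v)) (λ v → e v b)) (cong (sumOver S (e b) +_) no-loop) ⟩
    edgesIn r S + ∑[ v ∈ S ] e v b + (sumOver S (e b) + 0)     ≡⟨ cong (edgesIn r S + ∑[ v ∈ S ] e v b +_) (+-identityʳ _) ⟩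
    edgesIn r S + ∑[ v ∈ S ] e v b + sumOver S (e b)           ≡⟨ +-assoc (edgesIn r S) _ _ ⟩
    edgesIn r S + (∑[ v ∈ S ] e v b + sumOver S (e b))         ≡⟨ cong (edgesIn r S +_) (sumOver-+ S (λ u → e u b) (e b)) ⟨
    edgesIn r S + ∑[ u ∈ S ] (e u b + e b u)
      ≡⟨ cong (edgesIn r S +_) (sumOver-cong {S = S} (λ _ → refl) (up+up≡Adj r-inj b)) ⟩
    edgesIn r S + degIn S b                                    ∎
    where
    open ≡-Reasoning
    e : Fin n → Fin n → ℕ
    e v u = 𝟙 (up r v u)
    no-loop : e b b ≡ 0
    no-loop = cong (λ x → 𝟙 (x ∧ (r b <ᵇ r b))) (irrefl G b)

  anotherNeighbour : ∀ {S v} → 2 ≤ degIn S v → ∀ p → ∃ λ w → S w ≡ true × T (Adj G v w) × w ≢ p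
  anotherNeighbour {S} {v} 2≤deg p = found (sum-pos-except _ p (<-≤-trans (s≤s (term≤1 p)) 2≤deg))
    where
    term≤1 : ∀ u → (if S u then 𝟙 (Adj G v u) else 0) ≤ 1
    term≤1 u with S u
    ... | true  = 𝟙≤1 (Adj G v u)
    ... | false = z≤n
    member : ∀ u → 0 < (if S u then 𝟙 (Adj G v u) else 0) → S u ≡ true × T (Adj G v u)
    member u 0<term with S u | Adj G v u
    ... | true | true = refl , tt
    found : (∃ λ w → w ≢ p × 0 < (if S w then 𝟙 (Adj G v w) else 0)) →
            ∃ λ w → S w ≡ true × T (Adj G v w) × w ≢ p
    found (w , w≢p , 0<term) = let Sw , v~w = member w 0<term in w , Sw , v~w , w≢p

  chain-prefix : ∀ xs {w ys} → AdjChain G (xs ++ w ∷ ys) → AdjChain G (xs ++ w ∷ [])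
  chain-prefix []               _           = tt
  chain-prefix (x ∷ [])         (x~w , _)   = x~w , tt
  chain-prefix (x ∷ x' ∷ xs)    (x~x' , c)  = x~x' , chain-prefix (x' ∷ xs) c

  module _ (acyclic : ¬ HasCycle G) {S : Subset n} (branching : ∀ v → S v ≡ true → 2 ≤ degIn S v) where

    -- The path grows at its head x, never stepping back to y; as a repetition-free path has at
    -- most n vertices, the new neighbour eventually closes a cycle.
    walk : ∀ fuel {x y rest} → S x ≡ true → Unique (x ∷ y ∷ rest) → AdjChain G (x ∷ y ∷ rest) →
           n < fuel + length (x ∷ y ∷ rest) → ⊥
    walk zero _ path _ n<len = <⇒≱ n<len (Unique⇒length≤ path)
    walk (suc fuel) {x} {y} {rest} Sx path chain n<len
      with w , Sw , x~w , w≢y ← anotherNeighbour (branching x Sx) y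
      with Any.any? (w ≟_) rest
    ... | yes w∈rest with pre , post , refl ← ∈-∃++ w∈rest =
      acyclic (w , x ∷ y ∷ pre , unique-split (x ∷ y ∷ pre) path , s≤s (s≤s z≤n) ,
               subst T (Graph.sym G x w) x~w , chain-prefix (x ∷ y ∷ pre) chain)
    ... | no w∉rest =
      walk fuel Sw ((≢-sym (adjacent⇒≢ x~w) ∷ w≢y ∷ ¬Any⇒All¬ rest w∉rest) ∷ path)
           (subst T (Graph.sym G x w) x~w , chain) (subst (n <_) (sym (+-suc fuel _)) n<len)

  leaf : ¬ HasCycle G → ∀ {S s} → S s ≡ true → ∃ λ v → S v ≡ true × degIn S v ≤ 1
  leaf acyclic {S} {s} Ss with any? (λ v → (S v Bool.≟ true) ×-dec (degIn S v ≤? 1))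
  ... | yes found = found
  ... | no  none  = start (anotherNeighbour (branching s Ss) s)
    where
    branching : ∀ v → S v ≡ true → 2 ≤ degIn S v
    branching v Sv = ≰⇒> λ deg≤1 → none (v , Sv , deg≤1)
    start : (∃ λ w → S w ≡ true × T (Adj G s w) × w ≢ s) → ∃ λ v → S v ≡ true × degIn S v ≤ 1
    start (w , Sw , s~w , w≢s) =
      ⊥-elim (walk acyclic branching n Sw ((w≢s ∷ []) ∷ [] ∷ []) (subst T (Graph.sym G s w) s~w , tt)
                   (subst (n <_) (+-comm 2 n) (≤-trans (n<1+n n) (n≤1+n _))))

  edgesIn-acyclic : ¬ HasCycle G → ∀ {r} → Injective _≡_ _≡_ r → ∀ k {S} → size S ≡ suc k →
                    edgesIn r S ≤ k
  edgesIn-acyclic acyclic {r} r-inj k {S} ∣S∣≡1+k =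
    peel (leaf acyclic (proj₂ (nonempty⇒member {S = S} ∣S∣≡1+k)))
    where
    peel : (∃ λ v → S v ≡ true × degIn S v ≤ 1) → edgesIn r S ≤ k
    peel (v , Sv , deg≤1) = begin
      edgesIn r S                 ≡⟨ edgesIn-cong r (λ w → sym (insert-remove Sv w)) ⟩
      edgesIn r (insert S' v)     ≡⟨ edgesIn-insert r-inj (remove-self S v) ⟩
      edgesIn r S' + degIn S' v   ≤⟨ bound k ∣S'∣≡k ⟩
      k                           ∎
      where
      open ≤-Reasoning
      S' : Subset n
      S' = remove S v
      ∣S'∣≡k : size S' ≡ k
      ∣S'∣≡k = suc-injective (trans (+-comm 1 (size S'))
                                    (trans (sym (sumOver-remove {S = S} (λ _ → 1) Sv)) ∣S∣≡1+k))
      deg'≤1 : degIn S' v ≤ 1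
      deg'≤1 = ≤-trans (m≤m+n _ _)
                       (≤-trans (≤-reflexive (sym (sumOver-remove {S = S} (λ u → 𝟙 (Adj G v u)) Sv))) deg≤1)
      bound : ∀ j → size S' ≡ j → edgesIn r S' + degIn S' v ≤ j
      bound zero    ∣S'∣≡0 =
        ≤-reflexive (cong₂ _+_ (sumOver-empty {S = S'} _ ∣S'∣≡0) (sumOver-empty {S = S'} _ ∣S'∣≡0))
      bound (suc j) ∣S'∣≡1+j = ≤-trans (+-mono-≤ (edgesIn-acyclic acyclic r-inj j ∣S'∣≡1+j) deg'≤1)
                                       (≤-reflexive (+-comm j 1))

  crossingEdge : Connected G → ∀ {S : Subset n} {s w} → S s ≡ true → S w ≡ false →
             ∃ λ a → ∃ λ b → S a ≡ true × S b ≡ false × T (Adj G a b)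
  crossingEdge conn {S} {s} {w} Ss Sw with conn s w
  ... | x ∷ xs , chain , refl , last≡w = along x xs Ss chain last≡w
    where
    along : ∀ x xs → S x ≡ true → AdjChain G (x ∷ xs) → List.last (x ∷ xs) ≡ just w →
            ∃ λ a → ∃ λ b → S a ≡ true × S b ≡ false × T (Adj G a b)
    along x []       Sx _             refl   = contradiction (trans (sym Sx) Sw) λ ()
    along x (y ∷ ys) Sx (x~y , chain) last≡w with S y in Sy
    ... | true  = along y ys Sy chain last≡w
    ... | false = x , y , Sx , Sy , x~y

  edgesIn-connected : Connected G → ∀ {r} → Injective _≡_ _≡_ r → ∀ k → k < n →
                      ∃ λ S → size S ≡ suc k × k ≤ edgesIn r S
  edgesIn-connected conn r-inj zero 0<n =
    insert (λ _ → false) (fromℕ< 0<n) ,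
    trans (sumOver-insert {S = λ _ → false} {b = fromℕ< 0<n} (λ _ → 1) refl) (cong (_+ 1) (sum-replicate-zero n)) ,
    z≤n
  edgesIn-connected conn {r} r-inj (suc k) 1+k<n
    with S , ∣S∣≡1+k , k≤edges ← edgesIn-connected conn r-inj k (<⇒≤ 1+k<n)
    = grow (small⇒nonmember (subst (_< n) (sym ∣S∣≡1+k) 1+k<n)) (nonempty⇒member ∣S∣≡1+k)
    where
    grow : (∃ λ w → S w ≡ false) → (∃ λ s → S s ≡ true) →
           ∃ λ S' → size S' ≡ suc (suc k) × suc k ≤ edgesIn r S'
    grow (w , Sw) (s , Ss) with a , b , Sa , Sb , a~b ← crossingEdge conn Ss Sw =
      insert S b , trans (sumOver-insert {S = S} (λ _ → 1) Sb) (trans (+-comm _ 1) (cong suc ∣S∣≡1+k)) , (begin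
        suc k                     ≡⟨ +-comm 1 k ⟩
        k + 1                     ≤⟨ +-mono-≤ k≤edges b-joins ⟩
        edgesIn r S + degIn S b   ≡⟨ edgesIn-insert r-inj Sb ⟨
        edgesIn r (insert S b)    ∎)
      where
      open ≤-Reasoning
      b-joins : 1 ≤ degIn S b
      b-joins = subst (_≤ degIn S b)
        (trans (cong (λ x → if x then 𝟙 (Adj G b a) else 0) Sa) (𝟙-true (subst T (Graph.sym G a b) a~b)))
        (term≤sum _ a)

  outDeg-sum : IsTree G → 0 < n → ∀ {r} → Injective _≡_ _≡_ r → sum (outDeg r) ≡ n ∸ 1
  outDeg-sum (conn , acyclic) 0<n {r} r-inj = ≤-antisym
    (edgesIn-acyclic acyclic r-inj (n ∸ 1) (trans (sum-one n) (sym 1+[n∸1]≡n)))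
    (let S , _ , n∸1≤edges = edgesIn-connected conn r-inj (n ∸ 1) (≤-reflexive 1+[n∸1]≡n)
     in ≤-trans n∸1≤edges (edgesIn≤edges r S))
    where
    1+[n∸1]≡n : suc (n ∸ 1) ≡ n
    1+[n∸1]≡n = suc-pred n {{>-nonZero 0<n}}

  outDeg-all-above : ∀ {r t} → (∀ u → T (Adj G t u) → r t < r u) → outDeg r t ≡ deg G t
  outDeg-all-above {r} {t} above = ≤-antisym (outDeg≤deg r t)
    (≤-trans (≤-reflexive (deg≡sum t)) (sum-mono-≤ λ u → 𝟙-mono λ t~u → up-intro t~u (above u t~u)))

  lookup-removeChip-self : ∀ (c : Config G) j → lookup (c [ j ]%= pred) j ≡ pred (lookup c j)
  lookup-removeChip-self c j = lookup∘updateAt j {pred} c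

  lookup-removeChip-other : ∀ (c : Config G) {j v} → v ≢ j → lookup (c [ j ]%= pred) v ≡ lookup c v
  lookup-removeChip-other c {j} {v} v≢j = lookup∘updateAt′ v j {pred} v≢j c

  removeChip-≤ : ∀ (c : Config G) j v → lookup (c [ j ]%= pred) v ≤ lookup c v
  removeChip-≤ c j v with v ≟ j
  ... | yes refl = ≤-trans (≤-reflexive (lookup-removeChip-self c v)) pred[n]≤n
  ... | no v≢j   = ≤-reflexive (lookup-removeChip-other c v≢j)

  suc-removeChip-self : ∀ (c : Config G) {j} → 1 ≤ lookup c j → suc (lookup (c [ j ]%= pred) j) ≡ lookup c j
  suc-removeChip-self c {j} 1≤cⱼ = trans (cong suc (lookup-removeChip-self c j)) (suc-pred _ {{>-nonZero 1≤cⱼ}})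

  suc-chips-removeChip : ∀ (c : Config G) {j} → 1 ≤ lookup c j → suc (chips G (c [ j ]%= pred)) ≡ chips G c
  suc-chips-removeChip c {j} 1≤cⱼ = +-cancelʳ-≡ (lookup c′ j) _ _ (begin
    suc (chips G c′) + lookup c′ j    ≡⟨ +-suc (chips G c′) _ ⟨
    chips G c′ + suc (lookup c′ j)    ≡⟨ cong₂ _+_ (sum-lookup c′) (suc-removeChip-self c 1≤cⱼ) ⟩
    sum (lookup c′) + lookup c j      ≡⟨ sum-except-≡ j (λ v v≢j → lookup-removeChip-other c v≢j) ⟩
    sum (lookup c) + lookup c′ j      ≡⟨ cong (_+ lookup c′ j) (sum-lookup c) ⟨
    chips G c + lookup c′ j           ∎)
    where
    open ≡-Reasoning
    c′ : Config G
    c′ = c [ j ]%= pred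

  minusSelfReachable : 0 < n → ∀ {c j r} → Injective _≡_ _≡_ r → (∀ v → v ≢ j → outDeg r v ≤ lookup c v) →
                       outDeg r j < lookup c j → MinusSelfReachable G c j
  minusSelfReachable 0<n {c} {j} {r} r-inj off-j at-j =
    ≤-trans (s≤s z≤n) at-j , firingOrder⇒selfReachable 0<n order
    where
    fits : ∀ v → outDeg r v ≤ lookup (c [ j ]%= pred) v
    fits v with v ≟ j
    ... | yes refl = subst (outDeg r v ≤_) (sym (lookup-removeChip-self c v)) (pred-mono-≤ at-j)
    ... | no v≢j   = subst (outDeg r v ≤_) (sym (lookup-removeChip-other c v≢j)) (off-j v v≢j)
    order : FiringOrder (c [ j ]%= pred)
    order = record { rank = r ; rank-injective = r-inj ; outDeg≤chips = fits }

-- Near-minimal configurations on a tree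

module OnTree {n : ℕ} (G : Graph n) (tree : IsTree G) (0<n : 0 < n) where

  chips-lower : ∀ {c r} t → Injective _≡_ _≡_ r → (∀ v → v ≢ t → outDeg G r v ≤ lookup c v) →
                n ∸ 1 + lookup c t ≤ chips G c + outDeg G r t
  chips-lower {c} {r} t r-inj fits =
    subst₂ (λ e s → e + lookup c t ≤ s + outDeg G r t) (outDeg-sum G tree 0<n r-inj) (sym (sum-lookup c))
           (sum-except-≤ t fits)

  chips-upper : ∀ {c r} t → Injective _≡_ _≡_ r → (∀ v → v ≢ t → lookup c v ≤ outDeg G r v) →
                chips G c + outDeg G r t ≤ n ∸ 1 + lookup c t
  chips-upper {c} {r} t r-inj tight =
    subst₂ (λ s e → s + outDeg G r t ≤ e + lookup c t) (sym (sum-lookup c)) (outDeg-sum G tree 0<n r-inj)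
           (sum-except-≤ t tight)

  firingOrder : ∀ {c} → SelfReachable G c → FiringOrder G c
  firingOrder = selfReachable⇒firingOrder G (proj₁ tree)

  module OrderForMinus {ν : Config G} {t : Fin n} (1≤νₜ : 1 ≤ lookup ν t)
                       (o : FiringOrder G (ν [ t ]%= pred)) where
    open FiringOrder o renaming (rank to r)

    μ : Config G
    μ = ν [ t ]%= pred

    lowerNeighbour⇒minusSelfReachable : ∀ {u} → T (up G r u t) → (∀ w → T (up G r w t) → r w ≤ r u) →
                                        MinusSelfReachable G ν u
    lowerNeighbour⇒minusSelfReachable {u} u↑t u-highest = minusSelfReachable G 0<n r′-injective off-u at-u
      where
      open MoveBelow G rank-injective u↑t u-highest
      μ≤ν : ∀ v → lookup μ v ≤ lookup ν v
      μ≤ν = removeChip-≤ G ν t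
      off-u : ∀ v → v ≢ u → outDeg G r′ v ≤ lookup ν v
      off-u v _ = by-cases (v ≟ t)
        where
        by-cases : Dec (v ≡ t) → outDeg G r′ v ≤ lookup ν v
        by-cases (yes refl) = ≤-trans outDeg′-t (≤-trans (+-monoˡ-≤ 1 (outDeg≤chips v))
                                                         (≤-reflexive (trans (+-comm _ 1) (suc-removeChip-self G ν 1≤νₜ))))
        by-cases (no v≢t)   = ≤-trans (outDeg′-other v≢t) (≤-trans (outDeg≤chips v) (μ≤ν v))
      at-u : outDeg G r′ u < lookup ν u
      at-u = ≤-trans outDeg′-u (≤-trans (outDeg≤chips u) (μ≤ν u))

    highestLowerNeighbour : ∀ {u} → T (up G r u t) →
                            ∃ λ u* → T (up G r u* t) × (∀ w → T (up G r w t) → r w ≤ r u*)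
    highestLowerNeighbour {u} u↑t = u* , u*↑t , u*-highest
      where
      score : Fin n → ℕ
      score w = if up G r w t then suc (r w) else 0
      u* : Fin n
      u* = argmax score u (List.allFin n)
      beats : ∀ w → score w ≤ score u*
      beats w = v≤f[argmax]⁺ u (List.allFin n) (inj₂ (Any.map (λ { refl → ≤-refl }) (∈-allFin w)))
      score-pos : ∀ {w} → T (up G r w t) → score w ≡ suc (r w)
      score-pos {w} w↑t = cong (λ b → if b then suc (r w) else 0) (Equivalence.to T-≡ w↑t)
      u*↑t : T (up G r u* t)
      u*↑t with up G r u* t | beats u
      ... | true  | _ = tt
      ... | false | su≤0 = contradiction (subst (_≤ 0) (score-pos u↑t) su≤0) λ ()
      u*-highest : ∀ w → T (up G r w t) → r w ≤ r u*
      u*-highest w w↑t = s≤s⁻¹ (subst₂ _≤_ (score-pos w↑t) (score-pos u*↑t) (beats w))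

    module _ (unique : ∀ j → MinusSelfReachable G ν j → j ≡ t) where

      neighbours-above : ∀ u → T (Adj G t u) → r t < r u
      neighbours-above u t~u with <-cmp (r t) (r u)
      ... | tri< rt<ru _ _ = rt<ru
      ... | tri≈ _ rt≡ru _ = contradiction (rank-injective rt≡ru) (adjacent⇒≢ G t~u)
      ... | tri> _ _ ru<rt
        with u* , u*↑t , u*-highest ← highestLowerNeighbour (up-intro G (subst T (Graph.sym G t u) t~u) ru<rt)
        = contradiction (unique u* (lowerNeighbour⇒minusSelfReachable u*↑t u*-highest))
                        (adjacent⇒≢ G (proj₁ (up-elim G {r} u*↑t)))

      tight-off-t : ∀ j → j ≢ t → lookup μ j ≤ outDeg G r j
      tight-off-t j j≢t = ≮⇒≥ λ outDeg<μⱼ → j≢t (unique j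
        (minusSelfReachable G 0<n rank-injective (λ v _ → ≤-trans (outDeg≤chips v) (removeChip-≤ G ν t v))
                                                 (<-≤-trans outDeg<μⱼ (removeChip-≤ G ν t j))))

      chips-equation : n ∸ 1 + lookup μ t ≡ chips G μ + deg G t
      chips-equation = ≤-antisym
        (≤-trans (chips-lower {c = μ} t rank-injective (λ v _ → outDeg≤chips v)) (+-monoʳ-≤ _ (outDeg≤deg G r t)))
        (subst (λ d → chips G μ + d ≤ n ∸ 1 + lookup μ t) (outDeg-all-above G neighbours-above)
               (chips-upper {c = μ} t rank-injective tight-off-t))

  nearMinimal⇒equation : ∀ {ν t} → NearMinimallySelfReachableAbout G ν t →
                         lookup ν t + (n ∸ 1) ≡ chips G ν + deg G t
  nearMinimal⇒equation {ν} {t} (_ , _ , (1≤νₜ , μ-sr) , unique) = begin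
    lookup ν t + (n ∸ 1)              ≡⟨ cong (_+ (n ∸ 1)) (suc-removeChip-self G ν 1≤νₜ) ⟨
    suc (lookup μ t) + (n ∸ 1)        ≡⟨ cong suc (+-comm (lookup μ t) (n ∸ 1)) ⟩
    suc (n ∸ 1 + lookup μ t)          ≡⟨ cong suc (OrderForMinus.chips-equation 1≤νₜ (firingOrder μ-sr) unique) ⟩
    suc (chips G μ + deg G t)         ≡⟨ cong (_+ deg G t) (suc-chips-removeChip G ν 1≤νₜ) ⟩
    chips G ν + deg G t               ∎
    where
    open ≡-Reasoning
    μ : Config G
    μ = ν [ t ]%= pred

  equation⇒nearMinimal : ∀ {ν t} → n ≤ chips G ν → SelfReachable G ν →
                         lookup ν t + (n ∸ 1) ≡ chips G ν + deg G t → NearMinimallySelfReachableAbout G ν t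
  equation⇒nearMinimal {ν} {t} n≤ℓ sr equation = sr , not-minimal , minus-t , unique
    where
    open FiringOrder (firingOrder sr) renaming (rank to r)
    1+[n∸1]≡n : suc (n ∸ 1) ≡ n
    1+[n∸1]≡n = suc-pred n {{>-nonZero 0<n}}
    deg<νₜ : deg G t < lookup ν t
    deg<νₜ = +-cancelʳ-≤ (n ∸ 1) _ _ (begin
      suc (deg G t) + (n ∸ 1)     ≡⟨ cong suc (+-comm (deg G t) (n ∸ 1)) ⟩
      suc (n ∸ 1) + deg G t       ≡⟨ cong (_+ deg G t) 1+[n∸1]≡n ⟩
      n + deg G t                 ≤⟨ +-monoˡ-≤ (deg G t) n≤ℓ ⟩
      chips G ν + deg G t         ≡⟨ equation ⟨
      lookup ν t + (n ∸ 1)        ∎)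
      where open ≤-Reasoning
    not-minimal : ¬ MinimallySelfReachable G ν
    not-minimal (_ , ℓ≡n∸1) = 1+n≰n (subst (_≤ n ∸ 1) (sym 1+[n∸1]≡n) (subst (n ≤_) ℓ≡n∸1 n≤ℓ))
    minus-t : MinusSelfReachable G ν t
    minus-t = minusSelfReachable G 0<n rank-injective (λ v _ → outDeg≤chips v) (≤-<-trans (outDeg≤deg G r t) deg<νₜ)
    unique : ∀ j → MinusSelfReachable G ν j → j ≡ t
    unique j (1≤νⱼ , ν−j-sr) with j ≟ t
    ... | yes j≡t = j≡t
    ... | no j≢t = contradiction equation (<⇒≢ (begin-strict
      lookup ν t + (n ∸ 1)                 ≡⟨ +-comm (lookup ν t) (n ∸ 1) ⟩
      n ∸ 1 + lookup ν t                   ≡⟨ cong (n ∸ 1 +_) (lookup-removeChip-other G ν (≢-sym j≢t)) ⟨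
      n ∸ 1 + lookup ν′ t                  ≤⟨ chips-lower {c = ν′} t rank-injective′ (λ v _ → outDeg≤chips′ v) ⟩
      chips G ν′ + outDeg G r′ t           ≤⟨ +-monoʳ-≤ (chips G ν′) (outDeg≤deg G r′ t) ⟩
      chips G ν′ + deg G t                 <⟨ ≤-refl ⟩
      suc (chips G ν′) + deg G t           ≡⟨ cong (_+ deg G t) (suc-chips-removeChip G ν 1≤νⱼ) ⟩
      chips G ν + deg G t                  ∎))
      where
      open ≤-Reasoning
      ν′ : Config G
      ν′ = ν [ j ]%= pred
      open FiringOrder (firingOrder ν−j-sr)
        renaming (rank to r′; rank-injective to rank-injective′; outDeg≤chips to outDeg≤chips′)

lemma5p5 : (n : ℕ) → 1 ≤ n → (G : Graph n) → IsTree G → (t : Fin n) →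
    (ℓ : ℕ) → n ≤ ℓ → (ν : Config G) → chips G ν ≡ ℓ → SelfReachable G ν →
    (NearMinimallySelfReachableAbout G ν t ⇔
      (lookup ν t ≡ ℓ + deg G t + 1 ∸ n))
lemma5p5 (suc k) 0<n G tree t _ n≤ℓ ν refl sr =
  mk⇔ (λ near → trans (Equivalence.from solved (nearMinimal⇒equation near)) (sym shift))
      (λ νₜ≡ → equation⇒nearMinimal n≤ℓ sr (Equivalence.to solved (trans νₜ≡ shift)))
  where
  open OnTree G tree 0<n
  X : ℕ
  X = chips G ν + deg G t
  shift : X + 1 ∸ suc k ≡ X ∸ k
  shift = cong (_∸ suc k) (+-comm X 1)
  solved : (lookup ν t ≡ X ∸ k) ⇔ (lookup ν t + k ≡ X)
  solved = m≡n∸o⇔m+o≡n (≤-trans (n≤1+n k) (≤-trans n≤ℓ (m≤m+n _ _)))
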